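{- Let $H$ be any graph and let $A\subseteq V(H)$ be valid. Let $E_1(H)$ be the set of edges of $H$ with exactly one endpoint in $A$ and $E_0(H)$ the set of edges with no endpoint in $A$. Then for any maximum fractional matching $(w_e)_{e\in E(H)}$, \[\sum_{e\in E_1(H)}w_e=|A|\qquad\text{and}\qquad\sum_{e\in E_0(H)}w_e=c(H)-|A|.\]
   Context: Graphs have no isolated vertices. A fractional vertex cover of $H$ is $(c_v)$ with $c_v\ge0$ and $c_v+c_w\ge1$ for every edge $vw$; $c(H)$ is its minimum total weight, and covers attaining it are minimum. $A\subseteq V(H)$ is valid if there is a minimum fractional vertex cover with $c_v=1$ for $v\in A$ and $c_v\in\{0,\frac12\}$ for $v\notin A$. A fractional matching is $(w_e)$ with $w_e\ge0$ and $\sum_{e\ni v}w_e\le1$ for all $v$; it is maximum if $\sum_e w_e=c(H)$. -}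

module Defs where

open import Data.Nat using (ℕ; zero; suc)
import Data.Nat as N
open import Data.Fin using (Fin; zero; suc; _≟_)
open import Data.Fin.Subset using (Subset; _∈_; _∉_; ∣_∣)
open import Data.Product using (Σ; ∃; _×_; _,_; proj₁; proj₂)
open import Data.Sum using (_⊎_)
open import Data.Bool using (Bool; true; false; if_then_else_; _∨_)
open import Data.Vec using (lookup)
open import Data.Integer using (+_)
open import Data.Rational using (ℚ; 0ℚ; 1ℚ; ½; _+_; _≤_; _/_)
open import Relation.Binary.PropositionalEquality using (_≡_; _≢_)
open import Relation.Nullary using (¬_; does)

Σℚ : ∀ {k} → (Fin k → ℚ) → ℚ
Σℚ {zero}  f = 0ℚ
Σℚ {suc k} f = f zero + Σℚ (λ i → f (suc i))

record Graph : Set where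
  field
    n     : ℕ
    m     : ℕ
    ends  : Fin m → Fin n × Fin n
    loopless : ∀ e → proj₁ (ends e) ≢ proj₂ (ends e)
    simple : ∀ e f →
      ((proj₁ (ends e) ≡ proj₁ (ends f)) × (proj₂ (ends e) ≡ proj₂ (ends f))) ⊎
      ((proj₁ (ends e) ≡ proj₂ (ends f)) × (proj₂ (ends e) ≡ proj₁ (ends f))) →
      e ≡ f
    noIsolated : ∀ v → ∃ λ e → (proj₁ (ends e) ≡ v) ⊎ (proj₂ (ends e) ≡ v)

open Graph public

IsFVC : (H : Graph) → (Fin (n H) → ℚ) → Set
IsFVC H c = (∀ v → 0ℚ ≤ c v) ×
            (∀ e → 1ℚ ≤ c (proj₁ (ends H e)) + c (proj₂ (ends H e)))

-- Minimum fractional vertex cover: a cover of least total weight (its weight is c(H))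
IsMinFVC : (H : Graph) → (Fin (n H) → ℚ) → Set
IsMinFVC H c = IsFVC H c × (∀ c′ → IsFVC H c′ → Σℚ c ≤ Σℚ c′)

Valid : (H : Graph) → Subset (n H) → Set
Valid H A = ∃ λ c → IsMinFVC H c ×
  (∀ v → v ∈ A → c v ≡ 1ℚ) ×
  (∀ v → v ∉ A → (c v ≡ 0ℚ) ⊎ (c v ≡ ½))

[_]? : Bool → ℚ → ℚ
[ b ]? q = if b then q else 0ℚ

isEnd : (H : Graph) → Fin (n H) → Fin (m H) → Bool
isEnd H v e = does (proj₁ (ends H e) ≟ v) ∨ does (proj₂ (ends H e) ≟ v)

IsFM : (H : Graph) → (Fin (m H) → ℚ) → Set
IsFM H w = (∀ e → 0ℚ ≤ w e) × (∀ v → Σℚ (λ e → [ isEnd H v e ]? (w e)) ≤ 1ℚ)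

IsMaxFM : (H : Graph) → (Fin (m H) → ℚ) → Set
IsMaxFM H w = IsFM H w × ∃ λ c → IsMinFVC H c × (Σℚ w ≡ Σℚ c)

endsInA : (H : Graph) → Subset (n H) → Fin (m H) → ℕ
endsInA H A e = (if lookup A (proj₁ (ends H e)) then 1 else 0)
              N.+ (if lookup A (proj₂ (ends H e)) then 1 else 0)

inE₁ : (H : Graph) → Subset (n H) → Fin (m H) → Bool
inE₁ H A e = does (endsInA H A e N.≟ 1)

inE₀ : (H : Graph) → Subset (n H) → Fin (m H) → Bool
inE₀ H A e = does (endsInA H A e N.≟ 0)

ℕtoℚ : ℕ → ℚ
ℕtoℚ k = + k / 1

-- Complementary slackness: if c is a fractional vertex cover and w a fractional
-- matching of the same total weight, then double counting
--   Σ w ≤ Σₑ wₑ (c_a + c_b) = Σᵥ cᵥ (load of v) ≤ Σ c = Σ w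
-- forces equality termwise, so every vertex with cᵥ > 0 is saturated by w and every
-- edge with wₑ > 0 is covered with total weight exactly 1.  For the cover witnessing
-- that A is valid, the vertices of A are therefore saturated and edges inside A carry
-- no weight; double counting the weight at A then gives Σ_{E₁} w = |A|, and the
-- rest of Σ w = c(H) lies on E₀.
module Submission where

open import Defs
open import Data.Fin using (Fin)
open import Data.Fin.Subset using (Subset; ∣_∣)
open import Data.Product using (_×_)
open import Data.Rational using (ℚ; _-_)
open import Relation.Binary.PropositionalEquality using (_≡_)

open import Algebra.Bundles using (CommutativeRing)
import Algebra.Properties.Group as GroupProperties
import Algebra.Properties.Semiring.Sum as SemiringSum
open import Data.Bool using (Bool; true; false; if_then_else_; _∨_)
open import Data.Fin using (zero; suc; _≟_)
open import Data.Fin.Subset using (_∈_)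
import Data.Integer as ℤ
import Data.Integer.Properties as ℤ
open import Data.Nat as ℕ using (ℕ)
open import Data.Nat.Coprimality using (Coprime; 1-coprimeTo) renaming (sym to coprime-sym)
open import Data.Product using (_,_; proj₁; proj₂)
open import Data.Rational using (0ℚ; 1ℚ; _+_; _*_; _/_; _≤_; mkℚ; nonNegative)
open import Data.Rational.Properties
  using ( +-*-commutativeRing; +-0-group; +-comm; +-identityˡ; +-identityʳ
        ; *-comm; *-identityˡ; *-identityʳ; *-zeroˡ; *-zeroʳ; *-distribˡ-+
        ; ≤-refl; ≤-antisym; <-cmp; <-irrefl; <⇒≢; <-≤-trans
        ; +-mono-≤; +-mono-<-≤; *-monoˡ-≤-nonNeg; normalize-coprime; module ≤-Reasoning )
open import Data.Vec using ([]; _∷_; lookup)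
open import Data.Vec.Properties using (lookup⇒[]=)
open import Function using (_∘_)
open import Relation.Binary.Definitions using (tri<; tri≈; tri>)
open import Relation.Binary.PropositionalEquality
  using (refl; sym; trans; cong; cong₂; subst; _≢_; _≗_; module ≡-Reasoning)
open import Relation.Nullary using (yes; no; does)
open import Relation.Nullary.Negation using (contradiction)

module ℚ-Sum = SemiringSum (CommutativeRing.semiring +-*-commutativeRing)
open GroupProperties +-0-group using (∙-cancelˡ; x≈z//y)

Σℚ≡sum : ∀ {k} (f : Fin k → ℚ) → Σℚ f ≡ ℚ-Sum.sum f
Σℚ≡sum {ℕ.zero}  f = refl
Σℚ≡sum {ℕ.suc k} f = cong (f zero +_) (Σℚ≡sum (f ∘ suc))

Σℚ-cong : ∀ {k} {f g : Fin k → ℚ} → f ≗ g → Σℚ f ≡ Σℚ g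
Σℚ-cong {ℕ.zero}  f≗g = refl
Σℚ-cong {ℕ.suc k} f≗g = cong₂ _+_ (f≗g zero) (Σℚ-cong (f≗g ∘ suc))

Σℚ-zero : ∀ k → Σℚ {k} (λ _ → 0ℚ) ≡ 0ℚ
Σℚ-zero k = trans (Σℚ≡sum {k} (λ _ → 0ℚ)) (ℚ-Sum.sum-replicate-zero k)

Σℚ-distrib-+ : ∀ {k} (f g : Fin k → ℚ) → Σℚ (λ i → f i + g i) ≡ Σℚ f + Σℚ g
Σℚ-distrib-+ f g = begin
  Σℚ (λ i → f i + g i)            ≡⟨ Σℚ≡sum (λ i → f i + g i) ⟩
  ℚ-Sum.sum (λ i → f i + g i)     ≡⟨ ℚ-Sum.∑-distrib-+ f g ⟩
  ℚ-Sum.sum f + ℚ-Sum.sum g       ≡⟨ sym (cong₂ _+_ (Σℚ≡sum f) (Σℚ≡sum g)) ⟩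
  Σℚ f + Σℚ g                     ∎
  where open ≡-Reasoning

Σℚ-comm : ∀ {k l} (F : Fin k → Fin l → ℚ) →
          Σℚ (λ i → Σℚ (λ j → F i j)) ≡ Σℚ (λ j → Σℚ (λ i → F i j))
Σℚ-comm F = begin
  Σℚ (λ i → Σℚ (λ j → F i j))                ≡⟨ Σℚ-cong (λ i → Σℚ≡sum (F i)) ⟩
  Σℚ (λ i → ℚ-Sum.sum (λ j → F i j))         ≡⟨ Σℚ≡sum (λ i → ℚ-Sum.sum (F i)) ⟩
  ℚ-Sum.sum (λ i → ℚ-Sum.sum (λ j → F i j))  ≡⟨ ℚ-Sum.∑-comm F ⟩
  ℚ-Sum.sum (λ j → ℚ-Sum.sum (λ i → F i j))  ≡⟨ sym (Σℚ≡sum (λ j → ℚ-Sum.sum (λ i → F i j))) ⟩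
  Σℚ (λ j → ℚ-Sum.sum (λ i → F i j))         ≡⟨ sym (Σℚ-cong (λ j → Σℚ≡sum (λ i → F i j))) ⟩
  Σℚ (λ j → Σℚ (λ i → F i j))                ∎
  where open ≡-Reasoning

*-distribˡ-Σℚ : ∀ {k} x (f : Fin k → ℚ) → x * Σℚ f ≡ Σℚ (λ i → x * f i)
*-distribˡ-Σℚ x f = begin
  x * Σℚ f                      ≡⟨ cong (x *_) (Σℚ≡sum f) ⟩
  x * ℚ-Sum.sum f               ≡⟨ ℚ-Sum.*-distribˡ-sum x f ⟩
  ℚ-Sum.sum (λ i → x * f i)     ≡⟨ sym (Σℚ≡sum (λ i → x * f i)) ⟩
  Σℚ (λ i → x * f i)            ∎
  where open ≡-Reasoning

Σℚ-mono-≤ : ∀ {k} {f g : Fin k → ℚ} → (∀ i → f i ≤ g i) → Σℚ f ≤ Σℚ g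
Σℚ-mono-≤ {ℕ.zero}  f≤g = ≤-refl
Σℚ-mono-≤ {ℕ.suc k} f≤g = +-mono-≤ (f≤g zero) (Σℚ-mono-≤ (f≤g ∘ suc))

Σℚ-≤-tight : ∀ {k} {f g : Fin k → ℚ} → (∀ i → f i ≤ g i) → Σℚ f ≡ Σℚ g → f ≗ g
Σℚ-≤-tight {ℕ.suc k} {f} {g} f≤g Σf≡Σg = tight
  where
  head-tight : f zero ≡ g zero
  head-tight with <-cmp (f zero) (g zero)
  ... | tri≈ _ eq _ = eq
  ... | tri< lt _ _ = contradiction Σf≡Σg (<⇒≢ (+-mono-<-≤ lt (Σℚ-mono-≤ (f≤g ∘ suc))))
  ... | tri> _ _ gt = contradiction (<-≤-trans gt (f≤g zero)) (<-irrefl refl)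

  tight : f ≗ g
  tight zero    = head-tight
  tight (suc i) = Σℚ-≤-tight (f≤g ∘ suc)
    (∙-cancelˡ (f zero) _ _ (trans Σf≡Σg (cong (_+ _) (sym head-tight)))) i

*-[]?-comm : ∀ b x y → x * [ b ]? y ≡ y * [ b ]? x
*-[]?-comm true  x y = *-comm x y
*-[]?-comm false x y = trans (*-zeroʳ x) (sym (*-zeroʳ y))

Σℚ-select : ∀ {k} (a : Fin k) (f : Fin k → ℚ) → Σℚ (λ v → [ does (a ≟ v) ]? (f v)) ≡ f a
Σℚ-select {ℕ.suc k} zero    f = trans (cong (f zero +_) (Σℚ-zero k)) (+-identityʳ (f zero))
Σℚ-select {ℕ.suc k} (suc a) f = trans (+-identityˡ _) (Σℚ-select a (f ∘ suc))

[]?-∨-disjoint : ∀ {k} {a b : Fin k} → a ≢ b → ∀ v q →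
  [ does (a ≟ v) ∨ does (b ≟ v) ]? q ≡ [ does (a ≟ v) ]? q + [ does (b ≟ v) ]? q
[]?-∨-disjoint {a = a} {b} a≢b v q with a ≟ v | b ≟ v
... | yes refl | yes refl = contradiction refl a≢b
... | yes _    | no _     = sym (+-identityʳ q)
... | no _     | yes _    = sym (+-identityˡ q)
... | no _     | no _     = refl

Σℚ-select-pair : ∀ {k} {a b : Fin k} → a ≢ b → (f : Fin k → ℚ) →
  Σℚ (λ v → [ does (a ≟ v) ∨ does (b ≟ v) ]? (f v)) ≡ f a + f b
Σℚ-select-pair {a = a} {b} a≢b f = begin
  Σℚ (λ v → [ does (a ≟ v) ∨ does (b ≟ v) ]? (f v))
    ≡⟨ Σℚ-cong (λ v → []?-∨-disjoint a≢b v (f v)) ⟩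
  Σℚ (λ v → [ does (a ≟ v) ]? (f v) + [ does (b ≟ v) ]? (f v))
    ≡⟨ Σℚ-distrib-+ (λ v → [ does (a ≟ v) ]? (f v)) (λ v → [ does (b ≟ v) ]? (f v)) ⟩
  Σℚ (λ v → [ does (a ≟ v) ]? (f v)) + Σℚ (λ v → [ does (b ≟ v) ]? (f v))
    ≡⟨ cong₂ _+_ (Σℚ-select a f) (Σℚ-select b f) ⟩
  f a + f b ∎
  where open ≡-Reasoning

ℕtoℚ-suc : ∀ k → ℕtoℚ (ℕ.suc k) ≡ 1ℚ + ℕtoℚ k
ℕtoℚ-suc k = begin
  ℤ.+ ℕ.suc k / 1                         ≡⟨ cong (λ i → (ℤ.+ 1 ℤ.+ i) / 1) (sym (ℤ.*-identityʳ (ℤ.+ k))) ⟩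
  (ℤ.+ 1 ℤ.+ ℤ.+ k ℤ.* ℤ.+ 1) / 1         ≡⟨⟩
  1ℚ + mkℚ (ℤ.+ k) 0 k-coprime-1          ≡⟨ cong (1ℚ +_) (sym (normalize-coprime k-coprime-1)) ⟩
  1ℚ + ℕtoℚ k                             ∎
  where
  open ≡-Reasoning
  k-coprime-1 : Coprime k 1
  k-coprime-1 = coprime-sym (1-coprimeTo k)

χ : ∀ {k} → Subset k → Fin k → ℚ
χ A v = [ lookup A v ]? 1ℚ

Σℚ-χ : ∀ {k} (A : Subset k) → Σℚ (χ A) ≡ ℕtoℚ ∣ A ∣
Σℚ-χ []          = refl
Σℚ-χ (true  ∷ A) = trans (cong (1ℚ +_) (Σℚ-χ A)) (sym (ℕtoℚ-suc ∣ A ∣))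
Σℚ-χ (false ∷ A) = trans (+-identityˡ _) (Σℚ-χ A)

load : (H : Graph) → (Fin (m H) → ℚ) → Fin (n H) → ℚ
load H w v = Σℚ (λ e → [ isEnd H v e ]? (w e))

endSum : (H : Graph) → (Fin (n H) → ℚ) → Fin (m H) → ℚ
endSum H f e = f (proj₁ (ends H e)) + f (proj₂ (ends H e))

Σ-*-load≡Σ-*-endSum : ∀ H w (f : Fin (n H) → ℚ) →
  Σℚ (λ v → f v * load H w v) ≡ Σℚ (λ e → w e * endSum H f e)
Σ-*-load≡Σ-*-endSum H w f = begin
  Σℚ (λ v → f v * load H w v)
    ≡⟨ Σℚ-cong (λ v → *-distribˡ-Σℚ (f v) (λ e → [ isEnd H v e ]? (w e))) ⟩
  Σℚ (λ v → Σℚ (λ e → f v * [ isEnd H v e ]? (w e)))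
    ≡⟨ Σℚ-comm (λ v e → f v * [ isEnd H v e ]? (w e)) ⟩
  Σℚ (λ e → Σℚ (λ v → f v * [ isEnd H v e ]? (w e)))
    ≡⟨ Σℚ-cong (λ e → Σℚ-cong (λ v → *-[]?-comm (isEnd H v e) (f v) (w e))) ⟩
  Σℚ (λ e → Σℚ (λ v → w e * [ isEnd H v e ]? (f v)))
    ≡⟨ Σℚ-cong (λ e → sym (*-distribˡ-Σℚ (w e) (λ v → [ isEnd H v e ]? (f v)))) ⟩
  Σℚ (λ e → w e * Σℚ (λ v → [ isEnd H v e ]? (f v)))
    ≡⟨ Σℚ-cong (λ e → cong (w e *_) (Σℚ-select-pair (loopless H e) f)) ⟩
  Σℚ (λ e → w e * endSum H f e) ∎
  where open ≡-Reasoning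

minFVC-Σ-unique : ∀ H {c c′} → IsMinFVC H c → IsMinFVC H c′ → Σℚ c ≡ Σℚ c′
minFVC-Σ-unique H (c-cover , c-min) (c′-cover , c′-min) = ≤-antisym (c-min _ c′-cover) (c′-min _ c-cover)

≤-*-≥1 : ∀ {x y} → 0ℚ ≤ x → 1ℚ ≤ y → x ≤ x * y
≤-*-≥1 {x} 0≤x 1≤y = subst (_≤ x * _) (*-identityʳ x) (*-monoˡ-≤-nonNeg x {{nonNegative 0≤x}} 1≤y)

*-≤1-≤ : ∀ {x y} → 0ℚ ≤ x → y ≤ 1ℚ → x * y ≤ x
*-≤1-≤ {x} 0≤x y≤1 = subst (x * _ ≤_) (*-identityʳ x) (*-monoˡ-≤-nonNeg x {{nonNegative 0≤x}} y≤1)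

complementary-slackness : ∀ H {c w} → IsFVC H c → IsFM H w → Σℚ w ≡ Σℚ c →
  (∀ e → w e ≡ w e * endSum H c e) × (∀ v → c v * load H w v ≡ c v)
complementary-slackness H {c} {w} (c≥0 , c-covers) (w≥0 , load≤1) Σw≡Σc =
  Σℚ-≤-tight w≤w*endSum (≤-antisym (Σℚ-mono-≤ w≤w*endSum) Σw*endSum≤Σw) ,
  Σℚ-≤-tight c*load≤c (≤-antisym (Σℚ-mono-≤ c*load≤c) Σc≤Σc*load)
  where
  w≤w*endSum : ∀ e → w e ≤ w e * endSum H c e
  w≤w*endSum e = ≤-*-≥1 (w≥0 e) (c-covers e)

  c*load≤c : ∀ v → c v * load H w v ≤ c v
  c*load≤c v = *-≤1-≤ (c≥0 v) (load≤1 v)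

  Σw*endSum≤Σw : Σℚ (λ e → w e * endSum H c e) ≤ Σℚ w
  Σw*endSum≤Σw = begin
    Σℚ (λ e → w e * endSum H c e) ≡⟨ sym (Σ-*-load≡Σ-*-endSum H w c) ⟩
    Σℚ (λ v → c v * load H w v)   ≤⟨ Σℚ-mono-≤ c*load≤c ⟩
    Σℚ c                          ≡⟨ sym Σw≡Σc ⟩
    Σℚ w                          ∎
    where open ≤-Reasoning

  Σc≤Σc*load : Σℚ c ≤ Σℚ (λ v → c v * load H w v)
  Σc≤Σc*load = begin
    Σℚ c                          ≡⟨ sym Σw≡Σc ⟩
    Σℚ w                          ≤⟨ Σℚ-mono-≤ w≤w*endSum ⟩
    Σℚ (λ e → w e * endSum H c e) ≡⟨ sym (Σ-*-load≡Σ-*-endSum H w c) ⟩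
    Σℚ (λ v → c v * load H w v)   ∎
    where open ≤-Reasoning

-- Shaped like endsInA, so that inE₁ H A e and inE₀ H A e unfold to #true on the
-- memberships of the two ends of e.
#true : Bool → Bool → ℕ
#true x y = (if x then 1 else 0) ℕ.+ (if y then 1 else 0)

*-[]?-pair : ∀ x y q → (x ≡ true → y ≡ true → q ≡ 0ℚ) →
  q * ([ x ]? 1ℚ + [ y ]? 1ℚ) ≡ [ does (#true x y ℕ.≟ 1) ]? q
*-[]?-pair true  true  q q≡0 = trans (cong (_* _) (q≡0 refl refl)) (*-zeroˡ (1ℚ + 0ℚ))
*-[]?-pair true  false q _   = *-identityʳ q
*-[]?-pair false true  q _   = *-identityʳ q
*-[]?-pair false false q _   = *-zeroʳ q

[#true≟1]?+[#true≟0]? : ∀ x y q → (x ≡ true → y ≡ true → q ≡ 0ℚ) →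
  [ does (#true x y ℕ.≟ 1) ]? q + [ does (#true x y ℕ.≟ 0) ]? q ≡ q
[#true≟1]?+[#true≟0]? true  true  q q≡0 = trans (+-identityˡ 0ℚ) (sym (q≡0 refl refl))
[#true≟1]?+[#true≟0]? true  false q _   = +-identityʳ q
[#true≟1]?+[#true≟0]? false true  q _   = +-identityʳ q
[#true≟1]?+[#true≟0]? false false q _   = +-identityˡ q

module CoverOneOn (H : Graph) (A : Subset (n H)) {c : Fin (n H) → ℚ}
  (c-cover : IsFVC H c) (c-on-A : ∀ v → v ∈ A → c v ≡ 1ℚ)
  {w : Fin (m H) → ℚ} (w-matching : IsFM H w) (Σw≡Σc : Σℚ w ≡ Σℚ c) where

  private
    inA : Fin (n H) → Bool
    inA = lookup A

    c≡1 : ∀ {v} → inA v ≡ true → c v ≡ 1ℚ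
    c≡1 {v} v∈A = c-on-A v (lookup⇒[]= v A v∈A)

  load-on-A : ∀ {v} → inA v ≡ true → load H w v ≡ 1ℚ
  load-on-A {v} v∈A = begin
    load H w v        ≡⟨ sym (*-identityˡ _) ⟩
    1ℚ * load H w v   ≡⟨ cong (_* _) (sym (c≡1 v∈A)) ⟩
    c v * load H w v  ≡⟨ proj₂ (complementary-slackness H c-cover w-matching Σw≡Σc) v ⟩
    c v               ≡⟨ c≡1 v∈A ⟩
    1ℚ                ∎
    where open ≡-Reasoning

  weight-inside-A : ∀ e → inA (proj₁ (ends H e)) ≡ true → inA (proj₂ (ends H e)) ≡ true →
                    w e ≡ 0ℚ
  weight-inside-A e a∈A b∈A = sym (∙-cancelˡ (w e) 0ℚ (w e) (begin
    w e + 0ℚ              ≡⟨ +-identityʳ (w e) ⟩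
    w e                   ≡⟨ proj₁ (complementary-slackness H c-cover w-matching Σw≡Σc) e ⟩
    w e * endSum H c e    ≡⟨ cong (w e *_) (cong₂ _+_ (c≡1 a∈A) (c≡1 b∈A)) ⟩
    w e * (1ℚ + 1ℚ)       ≡⟨ *-distribˡ-+ (w e) 1ℚ 1ℚ ⟩
    w e * 1ℚ + w e * 1ℚ   ≡⟨ cong₂ _+_ (*-identityʳ (w e)) (*-identityʳ (w e)) ⟩
    w e + w e             ∎))
    where open ≡-Reasoning

  χ-*-load : ∀ v → χ A v * load H w v ≡ χ A v
  χ-*-load v with inA v in v∈A
  ... | true  = trans (*-identityˡ _) (load-on-A v∈A)
  ... | false = *-zeroˡ (load H w v)

  Σ-E₁ : Σℚ (λ e → [ inE₁ H A e ]? (w e)) ≡ ℕtoℚ ∣ A ∣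
  Σ-E₁ = begin
    Σℚ (λ e → [ inE₁ H A e ]? (w e))
      ≡⟨ Σℚ-cong (λ e → sym (*-[]?-pair _ _ (w e) (weight-inside-A e))) ⟩
    Σℚ (λ e → w e * endSum H (χ A) e)
      ≡⟨ sym (Σ-*-load≡Σ-*-endSum H w (χ A)) ⟩
    Σℚ (λ v → χ A v * load H w v)
      ≡⟨ Σℚ-cong χ-*-load ⟩
    Σℚ (χ A)
      ≡⟨ Σℚ-χ A ⟩
    ℕtoℚ ∣ A ∣ ∎
    where open ≡-Reasoning

  Σ-E₀+∣A∣ : Σℚ (λ e → [ inE₀ H A e ]? (w e)) + ℕtoℚ ∣ A ∣ ≡ Σℚ w
  Σ-E₀+∣A∣ = begin
    Σℚ E₀ + ℕtoℚ ∣ A ∣  ≡⟨ cong (Σℚ E₀ +_) (sym Σ-E₁) ⟩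
    Σℚ E₀ + Σℚ E₁       ≡⟨ +-comm (Σℚ E₀) (Σℚ E₁) ⟩
    Σℚ E₁ + Σℚ E₀       ≡⟨ sym (Σℚ-distrib-+ E₁ E₀) ⟩
    Σℚ (λ e → E₁ e + E₀ e)
      ≡⟨ Σℚ-cong (λ e → [#true≟1]?+[#true≟0]? _ _ (w e) (weight-inside-A e)) ⟩
    Σℚ w                ∎
    where
    open ≡-Reasoning
    E₁ E₀ : Fin (m H) → ℚ
    E₁ e = [ inE₁ H A e ]? (w e)
    E₀ e = [ inE₀ H A e ]? (w e)

lemma9p15 : (H : Graph) (A : Subset (n H)) → Valid H A →
    (w : Fin (m H) → ℚ) → IsMaxFM H w →
    (Σℚ (λ e → [ inE₁ H A e ]? (w e)) ≡ ℕtoℚ ∣ A ∣) ×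
    (∀ c → IsMinFVC H c → Σℚ (λ e → [ inE₀ H A e ]? (w e)) ≡ Σℚ c - ℕtoℚ ∣ A ∣)
lemma9p15 H A (c₀ , c₀-min , c₀-on-A , _) w (w-matching , _ , c₁-min , Σw≡Σc₁) =
  Σ-E₁ , λ c c-min → x≈z//y _ _ _ (trans Σ-E₀+∣A∣ (trans Σw≡Σc₀ (minFVC-Σ-unique H c₀-min c-min)))
  where
  Σw≡Σc₀ : Σℚ w ≡ Σℚ c₀
  Σw≡Σc₀ = trans Σw≡Σc₁ (minFVC-Σ-unique H c₁-min c₀-min)
  open CoverOneOn H A (proj₁ c₀-min) c₀-on-A w-matching Σw≡Σc₀
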